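{- Let $x,x_1\in S_{2n}$ and let $c_1\in S_{2n}$ be a cycle such that $x=c_1x_1$, $S(c_1)\cap S(x_1)=\emptyset$, and $t(S(c_1))\cap S(x)=\emptyset$. Then $\{v_i: i\in DS(c_1)\}$ is the vertex set of a connected component of the graph $\Gamma_x$.
   Context: $S_{2n}$ is the symmetric group on $[2n]$. The partner map $t$ is $t(2i-1)=2i$, $t(2i)=2i-1$, and couples are $D_i=\{2i-1,2i\}$, $\mathbb{D}=\{D_i\}$. For a permutation $x$: $S(x)=\{i:x(i)\neq i\}$, $D(x)=\{D_i\in\mathbb{D}:x(D_i)\notin\mathbb{D}\}$, $DS(x)=\bigcup_{D_i\in D(x)}D_i$. For $x\in S_{2n}$, the graph $\Gamma_x$ has vertex set $\{v_i: i\in[2n]\}$ with $v_i=(i,x(i))$, and edge set consisting of the straight edges $(v_{2i-1}:v_{2i})$, $i=1,\dots,n$, together with the curved edges $(v_{x^{ -1}(2i-1)}:v_{x^{ -1}(2i)})$, $i=1,\dots,n$. -}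

module Defs where

open import Data.Nat using (ℕ; zero; suc; _*_)
open import Data.Fin using (Fin; zero; suc; combine; remQuot)
open import Data.Fin.Permutation using (Permutation′; _⟨$⟩ʳ_; _⟨$⟩ˡ_)
open import Data.Product using (Σ; ∃; _×_; _,_; proj₁; proj₂)
open import Data.Sum using (_⊎_)
open import Data.Empty using (⊥)
open import Relation.Binary.PropositionalEquality using (_≡_)
open import Relation.Binary.Construct.Closure.ReflexiveTransitive using (Star)
open import Relation.Nullary using (¬_)
open import Function.Bundles using (_⇔_)

-- The ground set [2n] is Fin (n * 2) (0-based).  Element combine k b = 2k + b,
-- so the couple D_k (k : Fin n) is {2k, 2k+1}.

elt : (n : ℕ) → Fin n → Fin 2 → Fin (n * 2)
elt n k b = combine {n} {2} k b

couple : (n : ℕ) → Fin (n * 2) → Fin n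
couple n i = proj₁ (remQuot {n} 2 i)

flip2 : Fin 2 → Fin 2
flip2 zero = suc zero
flip2 (suc _) = zero

t : (n : ℕ) → Fin (n * 2) → Fin (n * 2)
t n i = elt n (proj₁ (remQuot {n} 2 i)) (flip2 (proj₂ (remQuot {n} 2 i)))

Subset : ℕ → Set₁
Subset n = Fin (n * 2) → Set

D : (n : ℕ) → Fin n → Subset n
D n k i = couple n i ≡ k

SetEq : (n : ℕ) → Subset n → Subset n → Set
SetEq n A B = ∀ j → A j ⇔ B j

img : (n : ℕ) → Permutation′ (n * 2) → Subset n → Subset n
img n x A j = ∃ λ i → A i × x ⟨$⟩ʳ i ≡ j

timg : (n : ℕ) → Subset n → Subset n
timg n A j = ∃ λ i → A i × t n i ≡ j

S : (n : ℕ) → Permutation′ (n * 2) → Subset n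
S n x i = ¬ (x ⟨$⟩ʳ i ≡ i)

-- D_k ∈ D(x)  iff  x(D_k) ∉ 𝔻
InD : (n : ℕ) → Permutation′ (n * 2) → Fin n → Set
InD n x k = ¬ (∃ λ m → SetEq n (img n x (D n k)) (D n m))

DS : (n : ℕ) → Permutation′ (n * 2) → Subset n
DS n x i = ∃ λ k → InD n x k × D n k i

Disjoint : (n : ℕ) → Subset n → Subset n → Set
Disjoint n A B = ∀ j → A j → B j → ⊥

iter : {m : ℕ} → Permutation′ m → ℕ → Fin m → Fin m
iter c zero i = i
iter c (suc k) i = c ⟨$⟩ʳ (iter c k i)

IsCycle : (n : ℕ) → Permutation′ (n * 2) → Set
IsCycle n c = (∃ λ i → S n c i) × (∀ i j → S n c i → S n c j → ∃ λ k → iter c k i ≡ j)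

-- The graph Γ_x: vertex v_i = (i, x(i)) is identified with i (i ↦ v_i is injective).
-- Straight edges (v_{2k} : v_{2k+1}) join i and t(i); curved edges
-- (v_{x⁻¹(2k)} : v_{x⁻¹(2k+1)}) join x⁻¹(a) and x⁻¹(t a).
data Edge (n : ℕ) (x : Permutation′ (n * 2)) : Fin (n * 2) → Fin (n * 2) → Set where
  straight : ∀ (k : Fin n) → Edge n x (elt n k zero) (elt n k (suc zero))
  curved   : ∀ (k : Fin n) → Edge n x (x ⟨$⟩ˡ elt n k zero) (x ⟨$⟩ˡ elt n k (suc zero))

Adj : (n : ℕ) → Permutation′ (n * 2) → Fin (n * 2) → Fin (n * 2) → Set
Adj n x a b = Edge n x a b ⊎ Edge n x b a

Reach : (n : ℕ) → Permutation′ (n * 2) → Fin (n * 2) → Fin (n * 2) → Set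
Reach n x = Star (Adj n x)

IsComponent : (n : ℕ) → Permutation′ (n * 2) → Subset n → Set
IsComponent n x V =
  (∃ λ a → V a)
  × (∀ a b → V a → V b → Reach n x a b)
  × (∀ a b → V a → Reach n x a b → V b)

module Submission where

-- Write A = S(c₁) for the support of the cycle.  The hypotheses say that x₁ fixes A
-- and that x fixes t(A); hence x agrees with c₁ on A, and c₁ fixes t(A) as well
-- (otherwise a point of A would be fixed by x).  Consequently:
--   * DS(c₁) = A ∪ t(A): a couple is broken by c₁ exactly when it meets A;
--   * in Γ_x every a ∈ A is joined to c₁(a) by the curved edge from
--     x⁻¹(c₁ a) = a to x⁻¹(t(c₁ a)) = t(c₁ a) followed by a straight edge, so the
--     single orbit A of c₁, and with it A ∪ t(A), is connected;
--   * A ∪ t(A) is closed under both kinds of edges, hence under reachability.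

open import Defs
open import Data.Nat using (ℕ; zero; suc; _*_)
open import Data.Fin using (Fin; zero; suc; remQuot; _≟_)
open import Data.Fin.Properties using (remQuot-combine; combine-remQuot)
open import Data.Fin.Permutation using (Permutation′; _⟨$⟩ʳ_; _⟨$⟩ˡ_; inverseˡ; inverseʳ)
open import Data.Product using (∃; _×_; _,_; proj₁; proj₂)
open import Data.Sum using (_⊎_; inj₁; inj₂)
open import Data.Empty using (⊥-elim)
open import Relation.Nullary using (¬_; yes; no)
open import Relation.Nullary.Decidable using (decidable-stable)
open import Relation.Binary.PropositionalEquality
open import Relation.Binary.Construct.Closure.ReflexiveTransitive using (ε; _◅_; _◅◅_)
open import Function.Bundles using (mk⇔; Equivalence)

module Permutations {m : ℕ} (π : Permutation′ m) where

  injective : ∀ {u v} → π ⟨$⟩ʳ u ≡ π ⟨$⟩ʳ v → u ≡ v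
  injective {u} {v} e = begin
    u                     ≡⟨ sym (inverseˡ π) ⟩
    π ⟨$⟩ˡ (π ⟨$⟩ʳ u)     ≡⟨ cong (π ⟨$⟩ˡ_) e ⟩
    π ⟨$⟩ˡ (π ⟨$⟩ʳ v)     ≡⟨ inverseˡ π ⟩
    v                     ∎
    where open ≡-Reasoning

  inverse-unique : ∀ {u v} → π ⟨$⟩ʳ u ≡ v → π ⟨$⟩ˡ v ≡ u
  inverse-unique e = trans (cong (π ⟨$⟩ˡ_) (sym e)) (inverseˡ π)

  moved-forward : ∀ {a} → ¬ π ⟨$⟩ʳ a ≡ a → ¬ π ⟨$⟩ʳ (π ⟨$⟩ʳ a) ≡ π ⟨$⟩ʳ a
  moved-forward s e = s (injective e)

  moved-backward : ∀ {a} → ¬ π ⟨$⟩ʳ a ≡ a → ¬ π ⟨$⟩ʳ (π ⟨$⟩ˡ a) ≡ π ⟨$⟩ˡ a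
  moved-backward {a} s e = s (trans (cong (π ⟨$⟩ʳ_) a≡π⁻¹a) (inverseʳ π))
    where
    a≡π⁻¹a : a ≡ π ⟨$⟩ˡ a
    a≡π⁻¹a = trans (sym (inverseʳ π)) e

module Couples (n : ℕ) where

  rem : Fin (n * 2) → Fin 2
  rem i = proj₂ (remQuot {n} 2 i)

  elt-couple-rem : ∀ i → elt n (couple n i) (rem i) ≡ i
  elt-couple-rem i = combine-remQuot {n} 2 i

  remQuot-t : ∀ i → remQuot {n} 2 (t n i) ≡ (couple n i , flip2 (rem i))
  remQuot-t i = remQuot-combine {n} {2} (couple n i) (flip2 (rem i))

  couple-t : ∀ i → couple n (t n i) ≡ couple n i
  couple-t i = cong proj₁ (remQuot-t i)

  t-elt : ∀ k b → t n (elt n k b) ≡ elt n k (flip2 b)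
  t-elt k b = cong (λ p → elt n (proj₁ p) (flip2 (proj₂ p))) (remQuot-combine {n} {2} k b)

  flip2-involutive : ∀ b → flip2 (flip2 b) ≡ b
  flip2-involutive zero = refl
  flip2-involutive (suc zero) = refl

  flip2-no-fixpoint : ∀ b → ¬ flip2 b ≡ b
  flip2-no-fixpoint zero ()
  flip2-no-fixpoint (suc zero) ()

  same-or-flipped : ∀ (b b′ : Fin 2) → b′ ≡ b ⊎ b′ ≡ flip2 b
  same-or-flipped zero zero = inj₁ refl
  same-or-flipped zero (suc zero) = inj₂ refl
  same-or-flipped (suc zero) zero = inj₂ refl
  same-or-flipped (suc zero) (suc zero) = inj₁ refl

  t-involutive : ∀ i → t n (t n i) ≡ i
  t-involutive i = begin
    t n (t n i)                              ≡⟨ cong (λ p → elt n (proj₁ p) (flip2 (proj₂ p))) (remQuot-t i) ⟩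
    elt n (couple n i) (flip2 (flip2 (rem i))) ≡⟨ cong (elt n (couple n i)) (flip2-involutive (rem i)) ⟩
    elt n (couple n i) (rem i)               ≡⟨ elt-couple-rem i ⟩
    i                                        ∎
    where open ≡-Reasoning

  t-no-fixpoint : ∀ i → ¬ t n i ≡ i
  t-no-fixpoint i e = flip2-no-fixpoint (rem i) (sym (trans (cong rem (sym e)) (cong proj₂ (remQuot-t i))))

  same-couple : ∀ i j → couple n j ≡ couple n i → j ≡ i ⊎ j ≡ t n i
  same-couple i j e with same-or-flipped (rem i) (rem j)
  ... | inj₁ e′ = inj₁ (trans (sym (elt-couple-rem j)) (trans (cong₂ (elt n) e e′) (elt-couple-rem i)))
  ... | inj₂ e′ = inj₂ (trans (sym (elt-couple-rem j)) (cong₂ (elt n) e e′))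

module Graph (n : ℕ) (x : Permutation′ (n * 2)) where
  open Couples n

  straight-adj : ∀ i → Adj n x i (t n i)
  straight-adj i = subst (λ j → Adj n x j (t n j)) (elt-couple-rem i) (on-elt (couple n i) (rem i))
    where
    on-elt : ∀ k b → Adj n x (elt n k b) (t n (elt n k b))
    on-elt k zero = subst (Adj n x (elt n k zero)) (sym (t-elt k zero)) (inj₁ (straight k))
    on-elt k (suc zero) = subst (Adj n x (elt n k (suc zero))) (sym (t-elt k (suc zero))) (inj₂ (straight k))

  curved-adj : ∀ w → Adj n x (x ⟨$⟩ˡ w) (x ⟨$⟩ˡ t n w)
  curved-adj w = subst (λ j → Adj n x (x ⟨$⟩ˡ j) (x ⟨$⟩ˡ t n j)) (elt-couple-rem w) (on-elt (couple n w) (rem w))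
    where
    on-elt : ∀ k b → Adj n x (x ⟨$⟩ˡ elt n k b) (x ⟨$⟩ˡ t n (elt n k b))
    on-elt k zero =
      subst (λ j → Adj n x (x ⟨$⟩ˡ elt n k zero) (x ⟨$⟩ˡ j)) (sym (t-elt k zero)) (inj₁ (curved k))
    on-elt k (suc zero) =
      subst (λ j → Adj n x (x ⟨$⟩ˡ elt n k (suc zero)) (x ⟨$⟩ˡ j)) (sym (t-elt k (suc zero))) (inj₂ (curved k))

  reach-sym : ∀ {a b} → Reach n x a b → Reach n x b a
  reach-sym ε = ε
  reach-sym (inj₁ e ◅ r) = reach-sym r ◅◅ (inj₂ e ◅ ε)
  reach-sym (inj₂ e ◅ r) = reach-sym r ◅◅ (inj₁ e ◅ ε)

  reach-closed : (V : Subset n)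
    → (∀ i → V i → V (t n i))
    → (∀ w → V (x ⟨$⟩ˡ w) → V (x ⟨$⟩ˡ t n w))
    → ∀ {a b} → Reach n x a b → V a → V b
  reach-closed V V-t V-curved = go
    where
    along-straight : ∀ k b → V (elt n k b) → V (elt n k (flip2 b))
    along-straight k b v = subst V (t-elt k b) (V-t _ v)

    along-curved : ∀ k b → V (x ⟨$⟩ˡ elt n k b) → V (x ⟨$⟩ˡ elt n k (flip2 b))
    along-curved k b v = subst (λ j → V (x ⟨$⟩ˡ j)) (t-elt k b) (V-curved _ v)

    forward : ∀ {u v} → Edge n x u v → V u → V v
    forward (straight k) = along-straight k zero
    forward (curved k) = along-curved k zero

    backward : ∀ {u v} → Edge n x u v → V v → V u
    backward (straight k) = along-straight k (suc zero)
    backward (curved k) = along-curved k (suc zero)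

    go : ∀ {a b} → Reach n x a b → V a → V b
    go ε v = v
    go (inj₁ e ◅ r) v = go r (forward e v)
    go (inj₂ e ◅ r) v = go r (backward e v)

module BrokenCouples (n : ℕ) (c : Permutation′ (n * 2)) where
  open Couples n
  open Permutations c

  Touches : Subset n
  Touches i = S n c i ⊎ S n c (t n i)

  touches-t : ∀ {i} → Touches i → Touches (t n i)
  touches-t {i} (inj₁ s) = inj₂ (subst (S n c) (sym (t-involutive i)) s)
  touches-t (inj₂ s) = inj₁ s

  -- a couple whose two points are fixed by c is mapped onto itself
  DS⇒touches : ∀ {i} → DS n c i → Touches i
  DS⇒touches {i} (k , broken , i∈Dk) with c ⟨$⟩ʳ i ≟ i | c ⟨$⟩ʳ t n i ≟ t n i
  ... | no s | _ = inj₁ s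
  ... | yes _ | no s = inj₂ s
  ... | yes fix-i | yes fix-ti = ⊥-elim (broken (k , Dk-invariant))
    where
    fixes-Dk : ∀ j → couple n j ≡ k → c ⟨$⟩ʳ j ≡ j
    fixes-Dk j j∈Dk with same-couple i j (trans j∈Dk (sym i∈Dk))
    ... | inj₁ refl = fix-i
    ... | inj₂ refl = fix-ti

    Dk-invariant : SetEq n (img n c (D n k)) (D n k)
    Dk-invariant j = mk⇔ (λ { (j′ , j′∈Dk , e) → subst (D n k) (trans (sym (fixes-Dk j′ j′∈Dk)) e) j′∈Dk })
                         (λ j∈Dk → j , j∈Dk , fixes-Dk j j∈Dk)

  -- if c moves a but fixes t a, then the couple D of a is broken: were c(D) a
  -- couple, it would contain c a and t a, forcing c a ∈ {a, t a}, both impossible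
  moved-couple-broken : ∀ {a} → S n c a → c ⟨$⟩ʳ t n a ≡ t n a → InD n c (couple n a)
  moved-couple-broken {a} s fix-ta (m , image≡Dm)
    with same-couple a (c ⟨$⟩ʳ a) (trans ca∈Dm (sym (trans (sym (couple-t a)) ta∈Dm)))
    where
    ca∈Dm : couple n (c ⟨$⟩ʳ a) ≡ m
    ca∈Dm = Equivalence.to (image≡Dm (c ⟨$⟩ʳ a)) (a , refl , refl)
    ta∈Dm : couple n (t n a) ≡ m
    ta∈Dm = Equivalence.to (image≡Dm (t n a)) (t n a , couple-t a , fix-ta)
  ... | inj₁ ca≡a = s ca≡a
  ... | inj₂ ca≡ta = t-no-fixpoint a (sym (injective (trans ca≡ta (sym fix-ta))))

  touches⇒DS : (∀ a → S n c a → c ⟨$⟩ʳ t n a ≡ t n a) → ∀ {i} → Touches i → DS n c i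
  touches⇒DS fixes-partners {i} (inj₁ s) =
    couple n i , moved-couple-broken s (fixes-partners i s) , refl
  touches⇒DS fixes-partners {i} (inj₂ s) =
    couple n (t n i) , moved-couple-broken s (fixes-partners (t n i) s) , sym (couple-t i)

module Factorisation (n : ℕ) (x x₁ c : Permutation′ (n * 2))
  (x≡cx₁ : ∀ i → x ⟨$⟩ʳ i ≡ c ⟨$⟩ʳ (x₁ ⟨$⟩ʳ i))
  (disjoint-supports : Disjoint n (S n c) (S n x₁))
  (partners-fixed : Disjoint n (timg n (S n c)) (S n x)) where
  open Couples n
  open Graph n x
  open BrokenCouples n c
  open Permutations c using (moved-forward; moved-backward)
  open Permutations x using (inverse-unique)

  x₁-fixes-support : ∀ {a} → S n c a → x₁ ⟨$⟩ʳ a ≡ a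
  x₁-fixes-support {a} s = decidable-stable (x₁ ⟨$⟩ʳ a ≟ a) (disjoint-supports a s)

  x-fixes-partner : ∀ {a} → S n c a → x ⟨$⟩ʳ t n a ≡ t n a
  x-fixes-partner {a} s = decidable-stable (x ⟨$⟩ʳ t n a ≟ t n a) (partners-fixed (t n a) (a , s , refl))

  x-agrees-with-c : ∀ {a} → S n c a → x ⟨$⟩ʳ a ≡ c ⟨$⟩ʳ a
  x-agrees-with-c {a} s = trans (x≡cx₁ a) (cong (c ⟨$⟩ʳ_) (x₁-fixes-support s))

  -- if c moved t a, then a = t (t a) would be fixed by x, yet x a = c a ≠ a
  c-fixes-partner : ∀ a → S n c a → c ⟨$⟩ʳ t n a ≡ t n a
  c-fixes-partner a s = decidable-stable (c ⟨$⟩ʳ t n a ≟ t n a) λ s′ →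
    partners-fixed a (t n a , s′ , t-involutive a) (λ xa≡a → s (trans (sym (x-agrees-with-c s)) xa≡a))

  touches-in-DS : ∀ {i} → Touches i → DS n c i
  touches-in-DS = touches⇒DS c-fixes-partner

  -- a — t(c a) is the curved edge over the couple of c a, then t(c a) — c a is straight
  reach-next : ∀ {a} → S n c a → Reach n x a (c ⟨$⟩ʳ a)
  reach-next {a} s =
    subst (λ u → Adj n x u (t n (c ⟨$⟩ʳ a))) x⁻¹ca≡a (subst (Adj n x _) x⁻¹tca≡tca (curved-adj (c ⟨$⟩ʳ a)))
    ◅ subst (Reach n x (t n (c ⟨$⟩ʳ a))) (t-involutive (c ⟨$⟩ʳ a)) (straight-adj (t n (c ⟨$⟩ʳ a)) ◅ ε)
    where
    x⁻¹ca≡a : x ⟨$⟩ˡ (c ⟨$⟩ʳ a) ≡ a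
    x⁻¹ca≡a = inverse-unique (x-agrees-with-c s)
    x⁻¹tca≡tca : x ⟨$⟩ˡ t n (c ⟨$⟩ʳ a) ≡ t n (c ⟨$⟩ʳ a)
    x⁻¹tca≡tca = inverse-unique (x-fixes-partner (moved-forward s))

  reach-iter : ∀ k {a} → S n c a → Reach n x a (iter c k a) × S n c (iter c k a)
  reach-iter zero s = ε , s
  reach-iter (suc k) s with reach-iter k s
  ... | r , s′ = r ◅◅ reach-next s′ , moved-forward s′

  reach-support : ∀ {i} → Touches i → ∃ λ a → S n c a × Reach n x i a
  reach-support {i} (inj₁ s) = i , s , ε
  reach-support {i} (inj₂ s) = t n i , s , straight-adj i ◅ ε

  DS-connected : (∀ i j → S n c i → S n c j → ∃ λ k → iter c k i ≡ j)
    → ∀ a b → DS n c a → DS n c b → Reach n x a b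
  DS-connected single-orbit a b a∈DS b∈DS
    with reach-support (DS⇒touches a∈DS) | reach-support (DS⇒touches b∈DS)
  ... | a₀ , sa , a→a₀ | b₀ , sb , b→b₀ with single-orbit a₀ b₀ sa sb
  ... | k , cᵏa₀≡b₀ =
    a→a₀ ◅◅ subst (Reach n x a₀) cᵏa₀≡b₀ (proj₁ (reach-iter k sa)) ◅◅ reach-sym b→b₀

  touches-curved : ∀ w → Touches (x ⟨$⟩ˡ w) → Touches (x ⟨$⟩ˡ t n w)
  touches-curved w (inj₁ s) = subst Touches (sym x⁻¹tw≡tw) (touches-t (inj₁ Sw))
    where
    w≡cu : w ≡ c ⟨$⟩ʳ (x ⟨$⟩ˡ w)
    w≡cu = trans (sym (inverseʳ x)) (x-agrees-with-c s)
    Sw : S n c w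
    Sw = subst (S n c) (sym w≡cu) (moved-forward s)
    x⁻¹tw≡tw : x ⟨$⟩ˡ t n w ≡ t n w
    x⁻¹tw≡tw = inverse-unique (x-fixes-partner Sw)
  touches-curved w (inj₂ s) = inj₁ (subst (S n c) (sym x⁻¹tw≡y) (moved-backward s))
    where
    u = x ⟨$⟩ˡ w
    y = c ⟨$⟩ˡ t n u
    w≡u : w ≡ u
    w≡u = trans (sym (inverseʳ x)) (subst (λ z → x ⟨$⟩ʳ z ≡ z) (t-involutive u) (x-fixes-partner s))
    xy≡tw : x ⟨$⟩ʳ y ≡ t n w
    xy≡tw = trans (x-agrees-with-c (moved-backward s)) (trans (inverseʳ c) (cong (t n) (sym w≡u)))
    x⁻¹tw≡y : x ⟨$⟩ˡ t n w ≡ y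
    x⁻¹tw≡y = inverse-unique xy≡tw

  DS-closed : ∀ a b → DS n c a → Reach n x a b → DS n c b
  DS-closed a b a∈DS a→b =
    touches-in-DS (reach-closed Touches (λ _ → touches-t) touches-curved a→b (DS⇒touches a∈DS))

lemma2p12 : (n : ℕ) (x x₁ c₁ : Permutation′ (n * 2))
    → IsCycle n c₁
    → (∀ i → x ⟨$⟩ʳ i ≡ c₁ ⟨$⟩ʳ (x₁ ⟨$⟩ʳ i))
    → Disjoint n (S n c₁) (S n x₁)
    → Disjoint n (timg n (S n c₁)) (S n x)
    → IsComponent n x (DS n c₁)
lemma2p12 n x x₁ c₁ ((a , a-moved) , single-orbit) x≡c₁x₁ disjoint-supports partners-fixed =
  (a , touches-in-DS (inj₁ a-moved)) , DS-connected single-orbit , DS-closed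
  where open Factorisation n x x₁ c₁ x≡c₁x₁ disjoint-supports partners-fixed
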